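{- Every multipath matroid is regular (representable over every field) and graphic.
   Context: Digraphs: finite, at most one edge $(v,w)$ from $v$ to $w$ for distinct $v,w$, finitely many loops allowed per vertex. A multipath of a digraph $G$ is a spanning subgraph each of whose connected components is a vertex or a simple path (sequence of non-loop edges, target of each = source of next, no repeated vertex, not closing into a cycle); $\mathrm{Mult}(G)$ is the set of multipaths as edge sets. A multipath matroid is a matroid of the form $M_G=(E(G),\mathrm{Mult}(G))$ for some digraph $G$ (i.e. when this pair is a matroid). A matroid is graphic if it is isomorphic to the matroid on the edge set of some undirected (multi)graph whose independent sets are the edge sets of subforests. -}

module Defs where

open import Level using (Level; _⊔_; Setω) renaming (zero to 0ℓ; suc to lsuc)
open import Data.Nat using (ℕ; zero; suc; _<_)
open import Data.Fin using (Fin; zero; suc)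
open import Data.Fin.Subset using (Subset; _∈_; _∉_; _⊆_; ⊥; _∪_; ⁅_⁆; ∣_∣)
open import Data.Product using (Σ; ∃; ∃-syntax; _×_; _,_)
open import Data.List using (List; []; _∷_)
open import Data.List.Relation.Unary.All using (All)
open import Data.List.Relation.Unary.Unique.Propositional using (Unique)
open import Relation.Binary.PropositionalEquality using (_≡_; _≢_)
open import Relation.Nullary using (¬_)
open import Algebra.Bundles using (CommutativeRing)

record IsMatroid (n : ℕ) (I : Subset n → Set) : Set where
  field
    empty-indep : I ⊥
    hereditary  : ∀ X Y → Y ⊆ X → I X → I Y
    augment     : ∀ X Y → I X → I Y → ∣ X ∣ < ∣ Y ∣ →
                  ∃[ e ] (e ∈ Y × e ∉ X × I (X ∪ ⁅ e ⁆))

-- Digraphs: vertices Fin nV, edges Fin nE with source and target.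
-- At most one edge v → w for distinct v, w; any finite number of loops.

record Digraph : Set where
  field
    nV nE  : ℕ
    src tgt : Fin nE → Fin nV
    simple : ∀ e f → src e ≢ tgt e → src e ≡ src f → tgt e ≡ tgt f → e ≡ f

module _ (G : Digraph) where
  open Digraph G

  data DWalk (S : Subset nE) : Fin nV → Fin nV → Set where
    []  : ∀ {v} → DWalk S v v
    _∷_ : ∀ {e w} → e ∈ S → DWalk S (tgt e) w → DWalk S (src e) w

  HasDirectedCycle : Subset nE → Set
  HasDirectedCycle S = ∃[ e ] (e ∈ S × DWalk S (tgt e) (src e))

  -- multipaths: spanning subgraphs whose components are isolated vertices
  -- or simple directed paths (no loops, in/out-degree ≤ 1, no cycle)
  IsMultipath : Subset nE → Set
  IsMultipath S =
      (∀ e → e ∈ S → src e ≢ tgt e)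
    × (∀ e f → e ∈ S → f ∈ S → src e ≡ src f → e ≡ f)
    × (∀ e f → e ∈ S → f ∈ S → tgt e ≡ tgt f → e ≡ f)
    × ¬ HasDirectedCycle S

module _ {n k : ℕ} (ends : Fin n → Fin k × Fin k) where

  Joins : Fin n → Fin k → Fin k → Set
  Joins e u w = ends e ≡ (u , w) Data.Sum.⊎ ends e ≡ (w , u)
    where import Data.Sum

  data UWalk : Fin k → Fin k → List (Fin n) → Set where
    []  : ∀ {v} → UWalk v v []
    _∷_ : ∀ {u w v e es} → Joins e u w → UWalk w v es → UWalk u v (e ∷ es)

  HasCycle : Subset n → Set
  HasCycle X = ∃[ v ] ∃[ e ] ∃[ es ]
    (UWalk v v (e ∷ es) × Unique (e ∷ es) × All (_∈ X) (e ∷ es))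

  IsForest : Subset n → Set
  IsForest X = ¬ HasCycle X

Graphic : {n : ℕ} → (Subset n → Set) → Set
Graphic {n} I = ∃[ k ] Σ (Fin n → Fin k × Fin k) λ ends →
  ∀ X → (I X → IsForest ends X) × (IsForest ends X → I X)

record Field (c ℓ : Level) : Set (lsuc (c ⊔ ℓ)) where
  field
    commutativeRing : CommutativeRing c ℓ
  open CommutativeRing commutativeRing public
  field
    0≉1     : ¬ (0# ≈ 1#)
    inverse : ∀ x → ¬ (x ≈ 0#) → ∃[ y ] (x * y ≈ 1#)

module _ {c ℓ : Level} (F : Field c ℓ) where
  open Field F using (Carrier; _≈_; _+_; _*_; 0#)

  sumF : ∀ {n} → (Fin n → Carrier) → Carrier
  sumF {zero}  f = 0#
  sumF {suc n} f = f zero + sumF (λ i → f (suc i))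

  LinIndep : ∀ {r n} → (Fin r → Fin n → Carrier) → Subset n → Set (c ⊔ ℓ)
  LinIndep {r} {n} A X = ∀ (coef : Fin n → Carrier) →
    (∀ e → e ∉ X → coef e ≈ 0#) →
    (∀ i → sumF (λ e → coef e * A i e) ≈ 0#) →
    ∀ e → coef e ≈ 0#

  Representable : ∀ {n} → (Subset n → Set) → Set (c ⊔ ℓ)
  Representable {n} I = ∃[ r ] Σ (Fin r → Fin n → Carrier) λ A →
    ∀ X → (I X → LinIndep A X) × (LinIndep A X → I X)

Regular : {n : ℕ} → (Subset n → Set) → Setω
Regular I = ∀ {c ℓ} (F : Field c ℓ) → Representable F I

record RegularAndGraphic {n : ℕ} (I : Subset n → Set) : Setω where
  field
    regular : Regular I
    graphic : Graphic I

-- Matroid augmentation makes parallelism of edges (two non-loops sharing their tail or their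
-- head, or forming a 2-cycle) an equivalence relation, and it forces every edge of a directed
-- cycle in a parallel-free set to be parallel to no other edge: augmenting the cycle minus one
-- edge from a path one edge longer would otherwise add an edge clashing with the cycle, or close
-- the cycle again.  So a set is a multipath iff it contains no loop, no two parallel edges and no
-- directed cycle of such solitary edges.  These are exactly the cycles of the multigraph that
-- keeps the loops and solitary edges of G and replaces every larger parallel class by a bundle
-- of parallel edges between two fresh vertices.  The signed incidence matrix of this multigraph
-- represents the multipath matroid over every field: a cycle yields a dependency, and on a
-- multipath the coefficients of a vanishing combination vanish one by one along directed paths
-- starting at sources.
module Submission where

open import Defs
open import Level using (0ℓ)
open import Function using (_∘_; case_of_)
open import Data.Bool using (true; false; if_then_else_)
open import Data.Bool.Properties using (xor-∧-commutativeRing)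
open import Data.Empty using (⊥-elim)
open import Data.Fin using (Fin; zero; suc; Fin′; inject; fromℕ<; toℕ; punchIn; _↑ˡ_; _↑ʳ_; splitAt)
open import Data.Fin.Properties
  using (_≟_; any?; all?; <-cmp; punchInᵢ≢i; toℕ-injective; toℕ-inject; toℕ-fromℕ<;
         splitAt-↑ˡ; splitAt-↑ʳ; ¬∀⟶∃¬-smallest)
open import Data.Fin.Subset using (Subset; _∈_; _∉_; _⊆_; ⊥; _∪_; ⁅_⁆; ∣_∣; outside; inside)
open import Data.Fin.Subset.Properties
  using (_∈?_; x∈p∪q⁻; x∈p∪q⁺; x∈⁅x⁆; x∈⁅y⁆⇒x≡y; x≢y⇒x∉⁅y⁆; ∉⊥; ∣p∣≤n; ∣⁅x⁆∣≡1;
         ∪-identityˡ; ∪-identityʳ)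
open import Data.List using (List; []; _∷_)
open import Data.List.Relation.Unary.All as All using (All; []; _∷_)
open import Data.List.Relation.Unary.AllPairs using ([]; _∷_)
open import Data.List.Relation.Unary.Unique.Propositional using (Unique)
open import Data.Nat using (ℕ; zero; suc; _≤_; _<_; s≤s; z≤n)
import Data.Nat
open import Data.Nat.Properties using (+-suc; m≤m+n; 1+n≰n; ≤-trans; n<1+n)
open import Data.Product as Product using (Σ; ∃-syntax; _×_; _,_; proj₁; proj₂)
open import Data.Sum as Sum using (_⊎_; inj₁; inj₂; [_,_])
open import Data.Unit using (⊤; tt)
open import Data.Vec using (_∷_; here; there)
open import Data.Vec.Functional using (removeAt)
open import Relation.Binary using (Decidable; tri<; tri≈; tri>)
open import Relation.Binary.PropositionalEquality as ≡
  using (_≡_; _≢_; refl; sym; trans; cong; cong₂; subst; subst₂)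
open import Relation.Nullary using (¬_; Dec; yes; no; does)
open import Relation.Nullary.Decidable
  using (_×-dec_; _⊎-dec_; _→-dec_; ¬?; dec-true; dec-false; decidable-stable)
open import Relation.Unary using (Pred)
import Algebra.Properties.Semiring.Sum as SemiringSum
import Algebra.Properties.Ring as RingProperties
import Algebra.Properties.AbelianGroup as AbelianGroupProperties
import Relation.Binary.Reasoning.Setoid as SetoidReasoning

private variable
  n : ℕ
  x y : Fin n
  p : Subset n

∈⁅⁆∪⁻ : y ∈ ⁅ x ⁆ ∪ p → y ≡ x ⊎ y ∈ p
∈⁅⁆∪⁻ {x = x} {p = p} y∈ = Sum.map₁ (x∈⁅y⁆⇒x≡y x) (x∈p∪q⁻ ⁅ x ⁆ p y∈)

∈⁅⁆∪-here : x ∈ ⁅ x ⁆ ∪ p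
∈⁅⁆∪-here {x = x} = x∈p∪q⁺ (inj₁ (x∈⁅x⁆ x))

∈⁅⁆∪-there : y ∈ p → y ∈ ⁅ x ⁆ ∪ p
∈⁅⁆∪-there y∈p = x∈p∪q⁺ (inj₂ y∈p)

∈∪⁅⁆-here : x ∈ p ∪ ⁅ x ⁆
∈∪⁅⁆-here {x = x} = x∈p∪q⁺ (inj₂ (x∈⁅x⁆ x))

∈∪⁅⁆-there : y ∈ p → y ∈ p ∪ ⁅ x ⁆
∈∪⁅⁆-there y∈p = x∈p∪q⁺ (inj₁ y∈p)

∈⁅⁆∪-elim : ∀ {ℓ} {P : Fin n → Set ℓ} → P x → (∀ y → y ∈ p → P y) → ∀ y → y ∈ ⁅ x ⁆ ∪ p → P y
∈⁅⁆∪-elim Px Pp y y∈ with ∈⁅⁆∪⁻ y∈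
... | inj₁ refl = Px
... | inj₂ y∈p  = Pp y y∈p

∈∧∉⇒≢ : y ∈ p → x ∉ p → y ≢ x
∈∧∉⇒≢ y∈p x∉p refl = x∉p y∈p

∣⁅x⁆∪p∣≡1+∣p∣ : x ∉ p → ∣ ⁅ x ⁆ ∪ p ∣ ≡ suc ∣ p ∣
∣⁅x⁆∪p∣≡1+∣p∣ {x = zero}  {outside ∷ p} x∉p = cong (suc ∘ ∣_∣) (∪-identityˡ p)
∣⁅x⁆∪p∣≡1+∣p∣ {x = zero}  {inside ∷ p}  x∉p = ⊥-elim (x∉p here)
∣⁅x⁆∪p∣≡1+∣p∣ {x = suc x} {outside ∷ p} x∉p = ∣⁅x⁆∪p∣≡1+∣p∣ (x∉p ∘ there)
∣⁅x⁆∪p∣≡1+∣p∣ {x = suc x} {inside ∷ p}  x∉p = cong suc (∣⁅x⁆∪p∣≡1+∣p∣ (x∉p ∘ there))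

inject-fromℕ< : {i j : Fin n} (i<j : toℕ i < toℕ j) → inject (fromℕ< i<j) ≡ i
inject-fromℕ< i<j = toℕ-injective (trans (toℕ-inject (fromℕ< i<j)) (toℕ-fromℕ< i<j))

least-unique : ∀ {ℓ} {P : Pred (Fin n) ℓ} {i j : Fin n} → P i → P j →
               (∀ (k : Fin′ i) → ¬ P (inject k)) → (∀ (k : Fin′ j) → ¬ P (inject k)) → i ≡ j
least-unique {P = P} {i} {j} Pi Pj i-least j-least with <-cmp i j
... | tri< i<j _ _ = ⊥-elim (j-least (fromℕ< i<j) (subst P (sym (inject-fromℕ< i<j)) Pi))
... | tri≈ _ i≡j _ = i≡j
... | tri> _ _ j<i = ⊥-elim (i-least (fromℕ< j<i) (subst P (sym (inject-fromℕ< j<i)) Pj))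

𝔽₂ : Field 0ℓ 0ℓ
𝔽₂ = record
  { commutativeRing = xor-∧-commutativeRing
  ; 0≉1             = λ ()
  ; inverse         = λ { false x≉0 → ⊥-elim (x≉0 refl) ; true _ → true , refl }
  }

module Incidence {c ℓ} (F : Field c ℓ) where
  open Field F hiding (zero) renaming (refl to ≈-refl; sym to ≈-sym; trans to ≈-trans)
  open SemiringSum semiring
  open RingProperties ring using (-1*x≈-x; -0#≈0#; -‿involutive)
  open AbelianGroupProperties +-abelianGroup using (⁻¹-anti-homo‿-)
  open SetoidReasoning setoid

  sumF≡sum : ∀ {n} (f : Fin n → Carrier) → sumF F f ≡ sum f
  sumF≡sum {zero}  f = refl
  sumF≡sum {suc n} f = cong (f zero +_) (sumF≡sum (f ∘ suc))

  sum-zero : ∀ {n} (f : Fin n → Carrier) → (∀ i → f i ≈ 0#) → sum f ≈ 0#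
  sum-zero {n} f f≈0 = ≈-trans (sum-cong-≋ f≈0) (sum-replicate-zero n)

  sum-single : ∀ {n} (f : Fin n → Carrier) i → (∀ j → j ≢ i → f j ≈ 0#) → sum f ≈ f i
  sum-single {suc n} f i others = begin
    sum f                     ≈⟨ sum-remove {i = i} f ⟩
    f i + sum (removeAt f i)  ≈⟨ +-congˡ (sum-zero _ (λ j → others (punchIn i j) (punchInᵢ≢i i j))) ⟩
    f i + 0#                  ≈⟨ +-identityʳ (f i) ⟩
    f i                       ∎

  telescope : ∀ x y z → (x - y) + (y - z) ≈ x - z
  telescope x y z = begin
    (x - y) + (y - z)    ≈⟨ +-assoc x (- y) (y - z) ⟩
    x + (- y + (y - z))  ≈⟨ +-congˡ (≈-sym (+-assoc (- y) y (- z))) ⟩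
    x + ((- y + y) - z)  ≈⟨ +-congˡ (+-congʳ (-‿inverseˡ y)) ⟩
    x + (0# - z)         ≈⟨ +-congˡ (+-identityˡ (- z)) ⟩
    x - z                ∎

  δ : ∀ {m} → Fin m → Fin m → Carrier
  δ i j = if does (i ≟ j) then 1# else 0#

  δ-diag : ∀ {m} (i : Fin m) → δ i i ≡ 1#
  δ-diag i rewrite dec-true (i ≟ i) refl = refl

  δ-off : ∀ {m} {i j : Fin m} → i ≢ j → δ i j ≡ 0#
  δ-off {i = i} {j} i≢j rewrite dec-false (i ≟ j) i≢j = refl

  pivot-zero : ∀ {r n} (A : Fin r → Fin n → Carrier) (coef : Fin n → Carrier) {i e} →
               sumF F (λ f → coef f * A i f) ≈ 0# → A i e ≈ 1# →
               (∀ f → f ≢ e → coef f * A i f ≈ 0#) → coef e ≈ 0#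
  pivot-zero A coef {i} {e} row Aie≈1 others = begin
    coef e                        ≈⟨ ≈-sym (*-identityʳ (coef e)) ⟩
    coef e * 1#                   ≈⟨ *-congˡ (≈-sym Aie≈1) ⟩
    coef e * A i e                ≈⟨ ≈-sym (sum-single _ e others) ⟩
    sum (λ f → coef f * A i f)    ≡⟨ sym (sumF≡sum (λ f → coef f * A i f)) ⟩
    sumF F (λ f → coef f * A i f) ≈⟨ row ⟩
    0#                            ∎

  module _ {n k} (ends : Fin n → Fin k × Fin k) where

    incidence : Fin k → Fin n → Carrier
    incidence v e = δ v (proj₁ (ends e)) - δ v (proj₂ (ends e))

    incidence-ends : ∀ {e a b} v → ends e ≡ (a , b) → incidence v e ≡ δ v a - δ v b
    incidence-ends v = cong λ ab → δ v (proj₁ ab) - δ v (proj₂ ab)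

    incidence-tail : ∀ {e a b} → ends e ≡ (a , b) → a ≢ b → incidence a e ≈ 1#
    incidence-tail {a = a} {b} eq a≢b = begin
      incidence a _  ≡⟨ incidence-ends a eq ⟩
      δ a a - δ a b  ≡⟨ cong₂ _-_ (δ-diag a) (δ-off a≢b) ⟩
      1# - 0#        ≈⟨ +-congˡ -0#≈0# ⟩
      1# + 0#        ≈⟨ +-identityʳ 1# ⟩
      1#             ∎

    incidence-elsewhere : ∀ {e a b v} → ends e ≡ (a , b) → v ≢ a → v ≢ b → incidence v e ≈ 0#
    incidence-elsewhere {v = v} eq v≢a v≢b = begin
      incidence v _  ≡⟨ incidence-ends v eq ⟩
      _ - _          ≡⟨ cong₂ _-_ (δ-off v≢a) (δ-off v≢b) ⟩
      0# - 0#        ≈⟨ -‿inverseʳ 0# ⟩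
      0#             ∎

    sign : ∀ {e u w} → Joins ends e u w → Carrier
    sign (inj₁ _) = 1#
    sign (inj₂ _) = - 1#

    sign-incidence : ∀ {e u w} (j : Joins ends e u w) i → sign j * incidence i e ≈ δ i u - δ i w
    sign-incidence (inj₁ eq) i = ≈-trans (*-identityˡ _) (reflexive (incidence-ends i eq))
    sign-incidence {u = u} {w} (inj₂ eq) i = begin
      - 1# * incidence i _  ≈⟨ -1*x≈-x _ ⟩
      - incidence i _       ≡⟨ cong -_ (incidence-ends i eq) ⟩
      - (δ i w - δ i u)     ≈⟨ ⁻¹-anti-homo‿- (δ i w) (δ i u) ⟩
      δ i u - δ i w         ∎

    sign≉0 : ∀ {e u w} (j : Joins ends e u w) → ¬ sign j ≈ 0#
    sign≉0 (inj₁ _) 1≈0  = 0≉1 (≈-sym 1≈0)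
    sign≉0 (inj₂ _) -1≈0 = 0≉1 (≈-sym (begin
      1#       ≈⟨ ≈-sym (-‿involutive 1#) ⟩
      - - 1#   ≈⟨ -‿cong -1≈0 ⟩
      - 0#     ≈⟨ -0#≈0# ⟩
      0#       ∎))

    flow : ∀ {u v es} → UWalk ends u v es → Fin n → Carrier
    flow []                   f = 0#
    flow (_∷_ {e = e} j walk) f = sign j * δ f e + flow walk f

    flow-boundary : ∀ {u v es} (walk : UWalk ends u v es) i →
                    sum (λ f → flow walk f * incidence i f) ≈ δ i u - δ i v
    flow-boundary {u} [] i = begin
      sum (λ f → 0# * incidence i f)  ≈⟨ sum-zero _ (λ f → zeroˡ (incidence i f)) ⟩
      0#                               ≈⟨ ≈-sym (-‿inverseʳ (δ i u)) ⟩
      δ i u - δ i u                    ∎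
    flow-boundary {u} {v} (_∷_ {w = w} {e = e} j walk) i = begin
      sum (λ f → (sign j * δ f e + flow walk f) * incidence i f)
        ≈⟨ sum-cong-≋ (λ f → distribʳ (incidence i f) _ _) ⟩
      sum (λ f → sign j * δ f e * incidence i f + flow walk f * incidence i f)
        ≈⟨ ∑-distrib-+ (λ f → sign j * δ f e * incidence i f) _ ⟩
      sum (λ f → sign j * δ f e * incidence i f) + sum (λ f → flow walk f * incidence i f)
        ≈⟨ +-cong (sum-single _ e off-e) (flow-boundary walk i) ⟩
      sign j * δ e e * incidence i e + (δ i w - δ i v)
        ≈⟨ +-congʳ (*-congʳ (≈-trans (*-congˡ (reflexive (δ-diag e))) (*-identityʳ (sign j)))) ⟩
      sign j * incidence i e + (δ i w - δ i v)
        ≈⟨ +-congʳ (sign-incidence j i) ⟩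
      (δ i u - δ i w) + (δ i w - δ i v)
        ≈⟨ telescope (δ i u) (δ i w) (δ i v) ⟩
      δ i u - δ i v ∎
      where
      off-e : ∀ f → f ≢ e → sign j * δ f e * incidence i f ≈ 0#
      off-e f f≢e = ≈-trans (*-congʳ (≈-trans (*-congˡ (reflexive (δ-off f≢e))) (zeroʳ (sign j))))
                            (zeroˡ (incidence i f))

    flow-outside : ∀ {u v es f} (walk : UWalk ends u v es) → All (f ≢_) es → flow walk f ≈ 0#
    flow-outside []                          []            = ≈-refl
    flow-outside {f = f} (_∷_ {e = e} j walk) (f≢e ∷ f∉es) = begin
      sign j * δ f e + flow walk f  ≈⟨ +-cong (≈-trans (*-congˡ (reflexive (δ-off f≢e))) (zeroʳ (sign j)))
                                              (flow-outside walk f∉es) ⟩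
      0# + 0#                       ≈⟨ +-identityʳ 0# ⟩
      0#                            ∎

    cycle-dependent : ∀ {X} → HasCycle ends X → ¬ LinIndep F incidence X
    cycle-dependent {X} (v , e , es , cycle@(j ∷ walk) , e∉es ∷ _ , e∈X ∷ es⊆X) independent =
      sign≉0 j (begin
        sign j                     ≈⟨ ≈-sym (*-identityʳ (sign j)) ⟩
        sign j * 1#                ≈⟨ ≈-sym (≈-trans (+-congˡ (flow-outside walk e∉es)) (+-identityʳ _)) ⟩
        sign j * 1# + flow walk e  ≡⟨ cong (λ x → sign j * x + flow walk e) (sym (δ-diag e)) ⟩
        flow cycle e               ≈⟨ independent (flow cycle) supported rows e ⟩
        0#                         ∎)
      where
      supported : ∀ f → f ∉ X → flow cycle f ≈ 0#
      supported f f∉X =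
        flow-outside cycle (All.map (λ x∈X f≡x → f∉X (subst (_∈ X) (sym f≡x) x∈X)) (e∈X ∷ es⊆X))
      rows : ∀ i → sumF F (λ f → flow cycle f * incidence i f) ≈ 0#
      rows i = begin
        sumF F (λ f → flow cycle f * incidence i f)  ≡⟨ sumF≡sum (λ f → flow cycle f * incidence i f) ⟩
        sum (λ f → flow cycle f * incidence i f)     ≈⟨ flow-boundary cycle i ⟩
        δ i v - δ i v                                ≈⟨ -‿inverseʳ (δ i v) ⟩
        0#                                           ∎

    independent⇒forest : ∀ {X} → LinIndep F incidence X → IsForest ends X
    independent⇒forest independent cycle = cycle-dependent cycle independent

module Walks (G : Digraph) where
  open Digraph G
  open Data.Nat using (_+_)

  infixr 5 _++_

  _++_ : ∀ {S u v w} → DWalk G S u v → DWalk G S v w → DWalk G S u w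
  []      ++ W = W
  (p ∷ V) ++ W = p ∷ (V ++ W)

  vertices : ∀ {S u v} → DWalk G S u v → Subset nV
  vertices {v = v} []        = ⁅ v ⁆
  vertices (_∷_ {e = e} _ W) = ⁅ src e ⁆ ∪ vertices W

  edges : ∀ {S u v} → DWalk G S u v → Subset nE
  edges []                = ⊥
  edges (_∷_ {e = e} _ W) = ⁅ e ⁆ ∪ edges W

  edgeList : ∀ {S u v} → DWalk G S u v → List (Fin nE)
  edgeList []                = []
  edgeList (_∷_ {e = e} _ W) = e ∷ edgeList W

  Simple : ∀ {S u v} → DWalk G S u v → Set
  Simple []                = ⊤
  Simple (_∷_ {e = e} _ W) = src e ∉ vertices W × Simple W

  start∈vertices : ∀ {S u v} (W : DWalk G S u v) → u ∈ vertices W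
  start∈vertices []      = x∈⁅x⁆ _
  start∈vertices (_ ∷ W) = ∈⁅⁆∪-here

  end∈vertices : ∀ {S u v} (W : DWalk G S u v) → v ∈ vertices W
  end∈vertices []      = x∈⁅x⁆ _
  end∈vertices (_ ∷ W) = ∈⁅⁆∪-there (end∈vertices W)

  src∈vertices : ∀ {S u v h} (W : DWalk G S u v) → h ∈ edges W → src h ∈ vertices W
  src∈vertices []      h∈ = ⊥-elim (∉⊥ h∈)
  src∈vertices (_ ∷ W) h∈ with ∈⁅⁆∪⁻ h∈
  ... | inj₁ refl = ∈⁅⁆∪-here
  ... | inj₂ h∈W  = ∈⁅⁆∪-there (src∈vertices W h∈W)

  tgt∈vertices : ∀ {S u v h} (W : DWalk G S u v) → h ∈ edges W → tgt h ∈ vertices W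
  tgt∈vertices []      h∈ = ⊥-elim (∉⊥ h∈)
  tgt∈vertices (_ ∷ W) h∈ with ∈⁅⁆∪⁻ h∈
  ... | inj₁ refl = ∈⁅⁆∪-there (start∈vertices W)
  ... | inj₂ h∈W  = ∈⁅⁆∪-there (tgt∈vertices W h∈W)

  edges⊆ : ∀ {S u v} (W : DWalk G S u v) → edges W ⊆ S
  edges⊆ []      h∈ = ⊥-elim (∉⊥ h∈)
  edges⊆ (p ∷ W) h∈ with ∈⁅⁆∪⁻ h∈
  ... | inj₁ refl = p
  ... | inj₂ h∈W  = edges⊆ W h∈W

  restrict : ∀ {S T u v} (W : DWalk G S u v) → edges W ⊆ T → DWalk G T u v
  restrict []      _   = []
  restrict (_ ∷ W) W⊆T = W⊆T ∈⁅⁆∪-here ∷ restrict W (W⊆T ∘ ∈⁅⁆∪-there)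

  all-edges : ∀ {ℓ} {P : Fin nE → Set ℓ} {S u v} (W : DWalk G S u v) →
              (∀ {h} → h ∈ edges W → P h) → All P (edgeList W)
  all-edges []      _       = []
  all-edges (_ ∷ W) P-edges = P-edges ∈⁅⁆∪-here ∷ all-edges W (P-edges ∘ ∈⁅⁆∪-there)

  start-or-entered : ∀ {S u v x} (W : DWalk G S u v) → x ∈ vertices W →
                     x ≡ u ⊎ ∃[ h ] (h ∈ edges W × tgt h ≡ x)
  start-or-entered []                x∈ = inj₁ (x∈⁅y⁆⇒x≡y _ x∈)
  start-or-entered (_∷_ {e = e} _ W) x∈ with ∈⁅⁆∪⁻ x∈
  ... | inj₁ x≡src = inj₁ x≡src
  ... | inj₂ x∈W with start-or-entered W x∈W
  ...   | inj₁ refl           = inj₂ (e , ∈⁅⁆∪-here , refl)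
  ...   | inj₂ (h , h∈W , eq) = inj₂ (h , ∈⁅⁆∪-there h∈W , eq)

  end-or-left : ∀ {S u v x} (W : DWalk G S u v) → x ∈ vertices W →
                x ≡ v ⊎ ∃[ h ] (h ∈ edges W × src h ≡ x)
  end-or-left []                x∈ = inj₁ (x∈⁅y⁆⇒x≡y _ x∈)
  end-or-left (_∷_ {e = e} _ W) x∈ with ∈⁅⁆∪⁻ x∈
  ... | inj₁ refl = inj₂ (e , ∈⁅⁆∪-here , refl)
  ... | inj₂ x∈W with end-or-left W x∈W
  ...   | inj₁ x≡v            = inj₁ x≡v
  ...   | inj₂ (h , h∈W , eq) = inj₂ (h , ∈⁅⁆∪-there h∈W , eq)

  prefix : ∀ {S u v x} (W : DWalk G S u v) → x ∈ vertices W → DWalk G S u x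
  prefix [] x∈ with x∈⁅y⁆⇒x≡y _ x∈
  ... | refl = []
  prefix (p ∷ W) x∈ with ∈⁅⁆∪⁻ x∈
  ... | inj₁ refl = []
  ... | inj₂ x∈W  = p ∷ prefix W x∈W

  suffix : ∀ {S u v x} (W : DWalk G S u v) → Simple W → x ∈ vertices W → Σ (DWalk G S x v) Simple
  suffix [] _ x∈ with x∈⁅y⁆⇒x≡y _ x∈
  ... | refl = [] , tt
  suffix (p ∷ W) simple x∈ with ∈⁅⁆∪⁻ x∈
  ... | inj₁ refl = p ∷ W , simple
  ... | inj₂ x∈W  = suffix W (proj₂ simple) x∈W

  erase : ∀ {S u v} → DWalk G S u v → Σ (DWalk G S u v) Simple
  erase [] = [] , tt
  erase (_∷_ {e = e} p W) with erase W
  ... | W′ , simple with src e ∈? vertices W′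
  ...   | yes src∈ = suffix W′ simple src∈
  ...   | no  src∉ = p ∷ W′ , src∉ , simple

  split-at : ∀ {S u v h} (W : DWalk G S u v) → h ∈ edges W → DWalk G S u (src h) × DWalk G S (tgt h) v
  split-at []      h∈ = ⊥-elim (∉⊥ h∈)
  split-at (p ∷ W) h∈ with ∈⁅⁆∪⁻ h∈
  ... | inj₁ refl = [] , W
  ... | inj₂ h∈W  = Product.map₁ (p ∷_) (split-at W h∈W)

  src≢end : ∀ {S u v h} (W : DWalk G S u v) → Simple W → h ∈ edges W → src h ≢ v
  src≢end []      _               h∈ = ⊥-elim (∉⊥ h∈)
  src≢end (_ ∷ W) (src∉ , simple) h∈ with ∈⁅⁆∪⁻ h∈
  ... | inj₁ refl = λ src≡v → src∉ (subst (_∈ vertices W) (sym src≡v) (end∈vertices W))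
  ... | inj₂ h∈W  = src≢end W simple h∈W

  tgt≢start : ∀ {S u v h} (W : DWalk G S u v) → Simple W → h ∈ edges W → tgt h ≢ u
  tgt≢start []      _               h∈ = ⊥-elim (∉⊥ h∈)
  tgt≢start (_ ∷ W) (src∉ , simple) h∈ with ∈⁅⁆∪⁻ h∈
  ... | inj₁ refl = λ tgt≡src → src∉ (subst (_∈ vertices W) tgt≡src (start∈vertices W))
  ... | inj₂ h∈W  = λ tgt≡src → src∉ (subst (_∈ vertices W) tgt≡src (tgt∈vertices W h∈W))

  first∉edges : ∀ {S v e} (p : e ∈ S) (W : DWalk G S (tgt e) v) → Simple (p ∷ W) → e ∉ edges W
  first∉edges _ W (src∉ , _) e∈W = src∉ (src∈vertices W e∈W)

  edgeList-unique : ∀ {S u v} (W : DWalk G S u v) → Simple W → Unique (edgeList W)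
  edgeList-unique []      _               = []
  edgeList-unique (_ ∷ W) (src∉ , simple) =
    all-edges W (λ h∈ e≡h → src∉ (subst (λ x → src x ∈ vertices W) (sym e≡h) (src∈vertices W h∈)))
    ∷ edgeList-unique W simple

  -- Backward walks are only extended by fresh vertices, so nV steps of fuel suffice.
  source-walk : ∀ {S} → ¬ HasDirectedCycle G S → ∀ v →
                ∃[ s ] ((∀ h → h ∈ S → tgt h ≢ s) × DWalk G S s v)
  source-walk {S} acyclic v = extend nV [] (m≤m+n nV _)
    where
    extend : ∀ fuel {u} (W : DWalk G S u v) → nV ≤ fuel + ∣ vertices W ∣ →
             ∃[ s ] ((∀ h → h ∈ S → tgt h ≢ s) × DWalk G S s v)
    extend fuel {u} W bound with any? (λ h → (h ∈? S) ×-dec (tgt h ≟ u))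
    ... | no none = u , (λ h h∈S tgt≡u → none (h , h∈S , tgt≡u)) , W
    ... | yes (h , h∈S , refl) with src h ∈? vertices W
    ...   | yes src∈ = ⊥-elim (acyclic (h , h∈S , prefix W src∈))
    ...   | no  src∉ with fuel | ∣⁅x⁆∪p∣≡1+∣p∣ src∉
    ...     | zero     | grown =
              ⊥-elim (1+n≰n (≤-trans (subst (_≤ nV) grown (∣p∣≤n (⁅ src h ⁆ ∪ vertices W))) bound))
    ...     | suc fuel | grown =
              extend fuel (h∈S ∷ W)
                (subst (nV ≤_) (trans (sym (+-suc fuel _)) (cong (fuel +_) (sym grown))) bound)

  InjectiveOn : (Fin nE → Fin nV) → Subset nE → Set
  InjectiveOn φ S = ∀ e f → e ∈ S → f ∈ S → φ e ≡ φ f → e ≡ f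

  injectiveOn-insert : ∀ {φ S e} → InjectiveOn φ S → (∀ h → h ∈ S → φ h ≢ φ e) → InjectiveOn φ (⁅ e ⁆ ∪ S)
  injectiveOn-insert injective new f f′ f∈ f′∈ φf≡φf′ with ∈⁅⁆∪⁻ f∈ | ∈⁅⁆∪⁻ f′∈
  ... | inj₁ refl | inj₁ refl = refl
  ... | inj₁ refl | inj₂ f′∈S = ⊥-elim (new f′ f′∈S (sym φf≡φf′))
  ... | inj₂ f∈S  | inj₁ refl = ⊥-elim (new f f∈S φf≡φf′)
  ... | inj₂ f∈S  | inj₂ f′∈S = injective f f′ f∈S f′∈S φf≡φf′

  ⊥-multipath : IsMultipath G ⊥
  ⊥-multipath = (λ _ h∈ → ⊥-elim (∉⊥ h∈)) , (λ _ _ h∈ → ⊥-elim (∉⊥ h∈)) , (λ _ _ h∈ → ⊥-elim (∉⊥ h∈))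
              , λ (_ , h∈ , _) → ∉⊥ h∈

  multipath-cons : ∀ {S e} → IsMultipath G S → src e ≢ tgt e →
                   (∀ h → h ∈ S → src h ≢ src e × tgt h ≢ src e × tgt h ≢ tgt e) →
                   IsMultipath G (⁅ e ⁆ ∪ S)
  multipath-cons {S} {e} (loopless , src-injective , tgt-injective , acyclic) e-nonloop fresh =
      ∈⁅⁆∪-elim e-nonloop loopless
    , injectiveOn-insert src-injective (λ h → proj₁ ∘ fresh h)
    , injectiveOn-insert tgt-injective (λ h → proj₂ ∘ proj₂ ∘ fresh h)
    , acyclic′
    where
    unentered : ∀ h → h ∈ ⁅ e ⁆ ∪ S → tgt h ≢ src e
    unentered = ∈⁅⁆∪-elim (e-nonloop ∘ sym) (λ h → proj₁ ∘ proj₂ ∘ fresh h)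
    avoid : ∀ {u v} → DWalk G (⁅ e ⁆ ∪ S) u v → u ≢ src e → v ≢ src e × DWalk G S u v
    avoid []                 u≢ = u≢ , []
    avoid (_∷_ {e = x} x∈ W) u≢ with ∈⁅⁆∪⁻ x∈
    ... | inj₁ refl = ⊥-elim (u≢ refl)
    ... | inj₂ x∈S  = Product.map₂ (x∈S ∷_) (avoid W (unentered x x∈))
    acyclic′ : ¬ HasDirectedCycle G (⁅ e ⁆ ∪ S)
    acyclic′ (h , h∈ , W) with ∈⁅⁆∪⁻ h∈
    ... | inj₁ refl = proj₁ (avoid W (unentered h h∈)) refl
    ... | inj₂ h∈S  = acyclic (h , h∈S , proj₂ (avoid W (unentered h h∈)))

  multipath-snoc : ∀ {S e} → IsMultipath G S → src e ≢ tgt e →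
                   (∀ h → h ∈ S → tgt h ≢ tgt e × src h ≢ tgt e × src h ≢ src e) →
                   IsMultipath G (⁅ e ⁆ ∪ S)
  multipath-snoc {S} {e} (loopless , src-injective , tgt-injective , acyclic) e-nonloop fresh =
      ∈⁅⁆∪-elim e-nonloop loopless
    , injectiveOn-insert src-injective (λ h → proj₂ ∘ proj₂ ∘ fresh h)
    , injectiveOn-insert tgt-injective (λ h → proj₁ ∘ fresh h)
    , acyclic′
    where
    unleft : ∀ h → h ∈ ⁅ e ⁆ ∪ S → src h ≢ tgt e
    unleft = ∈⁅⁆∪-elim e-nonloop (λ h → proj₁ ∘ proj₂ ∘ fresh h)
    avoid : ∀ {u v} → DWalk G (⁅ e ⁆ ∪ S) u v → v ≢ tgt e → u ≢ tgt e × DWalk G S u v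
    avoid []                 v≢ = v≢ , []
    avoid (_∷_ {e = x} x∈ W) v≢ with avoid W v≢ | ∈⁅⁆∪⁻ x∈
    ... | tgt≢ , _  | inj₁ refl = ⊥-elim (tgt≢ refl)
    ... | _    , W′ | inj₂ x∈S  = unleft x x∈ , x∈S ∷ W′
    acyclic′ : ¬ HasDirectedCycle G (⁅ e ⁆ ∪ S)
    acyclic′ (h , h∈ , W) with ∈⁅⁆∪⁻ h∈
    ... | inj₁ refl = proj₁ (avoid W (unleft h h∈)) refl
    ... | inj₂ h∈S  = acyclic (h , h∈S , proj₂ (avoid W (unleft h h∈)))

  path-multipath : ∀ {S u v} (W : DWalk G S u v) → Simple W → IsMultipath G (edges W)
  path-multipath []      _               = ⊥-multipath
  path-multipath (_ ∷ W) (src∉ , simple) =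
    multipath-cons (path-multipath W simple) (λ eq → ∈∧∉⇒≢ (start∈vertices W) src∉ (sym eq))
      (λ h h∈ → ∈∧∉⇒≢ (src∈vertices W h∈) src∉ , ∈∧∉⇒≢ (tgt∈vertices W h∈) src∉ , tgt≢start W simple h∈)

module Parallel (G : Digraph) where
  open Digraph G
  open Walks G

  NonLoop : Fin nE → Set
  NonLoop e = src e ≢ tgt e

  Clash : Fin nE → Fin nE → Set
  Clash e f = src e ≡ src f ⊎ tgt e ≡ tgt f ⊎ (src e ≡ tgt f × tgt e ≡ src f)

  infix 4 _∥_ _∥?_

  -- For e ≢ f this says exactly that {e , f} is a circuit of the multipath matroid.
  _∥_ : Fin nE → Fin nE → Set
  e ∥ f = NonLoop e × NonLoop f × Clash e f

  _∥?_ : Decidable _∥_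
  e ∥? f = ¬? (src e ≟ tgt e) ×-dec ¬? (src f ≟ tgt f) ×-dec
           (src e ≟ src f ⊎-dec tgt e ≟ tgt f ⊎-dec (src e ≟ tgt f ×-dec tgt e ≟ src f))

  ∥-refl : ∀ {e} → NonLoop e → e ∥ e
  ∥-refl nonloop = nonloop , nonloop , inj₁ refl

  ∥-sym : ∀ {e f} → e ∥ f → f ∥ e
  ∥-sym (e-nonloop , f-nonloop , clash) = f-nonloop , e-nonloop , Clash-sym clash
    where
    Clash-sym : ∀ {e f} → Clash e f → Clash f e
    Clash-sym (inj₁ src≡)                = inj₁ (sym src≡)
    Clash-sym (inj₂ (inj₁ tgt≡))         = inj₂ (inj₁ (sym tgt≡))
    Clash-sym (inj₂ (inj₂ (src≡ , tgt≡))) = inj₂ (inj₂ (sym tgt≡ , sym src≡))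

  ∥-dependent : ∀ {S e f} → e ∥ f → e ≢ f → e ∈ S → f ∈ S → ¬ IsMultipath G S
  ∥-dependent (_ , _ , inj₁ src≡) e≢f e∈S f∈S (_ , src-injective , _ , _) =
    e≢f (src-injective _ _ e∈S f∈S src≡)
  ∥-dependent (_ , _ , inj₂ (inj₁ tgt≡)) e≢f e∈S f∈S (_ , _ , tgt-injective , _) =
    e≢f (tgt-injective _ _ e∈S f∈S tgt≡)
  ∥-dependent {S} {e} (_ , _ , inj₂ (inj₂ (src≡ , tgt≡))) _ e∈S f∈S (_ , _ , _ , acyclic) =
    acyclic (e , e∈S , subst₂ (DWalk G S) (sym tgt≡) (sym src≡) (f∈S ∷ []))

  singleton-multipath : ∀ {g} → NonLoop g → IsMultipath G ⁅ g ⁆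
  singleton-multipath {g} nonloop =
    subst (IsMultipath G) (∪-identityʳ ⁅ g ⁆) (multipath-cons ⊥-multipath nonloop (λ _ h∈ → ⊥-elim (∉⊥ h∈)))

  pair-multipath : ∀ {e g} → NonLoop e → NonLoop g → ¬ Clash e g → IsMultipath G (⁅ e ⁆ ∪ ⁅ g ⁆)
  pair-multipath {e} {g} e-nonloop g-nonloop no-clash with src g ≟ tgt e
  ... | no src≢ = multipath-snoc (singleton-multipath g-nonloop) e-nonloop λ h h∈ →
        case x∈⁅y⁆⇒x≡y g h∈ of λ where
          refl → (no-clash ∘ inj₂ ∘ inj₁ ∘ sym) , src≢ , (no-clash ∘ inj₁ ∘ sym)
  ... | yes src≡ = multipath-cons (singleton-multipath g-nonloop) e-nonloop λ h h∈ →
        case x∈⁅y⁆⇒x≡y g h∈ of λ where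
          refl → (no-clash ∘ inj₁ ∘ sym) , (λ tgt≡ → no-clash (inj₂ (inj₂ (sym tgt≡ , sym src≡))))
               , (no-clash ∘ inj₂ ∘ inj₁ ∘ sym)

  Solitary : Fin nE → Set
  Solitary e = ∀ f → e ∥ f → f ≡ e

  solitary? : ∀ e → Dec (Solitary e)
  solitary? e = all? λ f → (e ∥? f) →-dec (f ≟ e)

  ¬solitary⇒nonloop : ∀ {e} → ¬ Solitary e → NonLoop e
  ¬solitary⇒nonloop ¬solitary loop = ¬solitary λ f e∥f → ⊥-elim (proj₁ e∥f loop)

  ∥⇒¬solitary : ∀ {e f} → e ∥ f → f ≢ e → ¬ Solitary e
  ∥⇒¬solitary e∥f f≢e solitary = f≢e (solitary _ e∥f)

  ParallelFree : Subset nE → Set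
  ParallelFree X = ∀ e f → e ∈ X → f ∈ X → e ∥ f → e ≡ f

module MultipathMatroid (G : Digraph) (M : IsMatroid (Digraph.nE G) (IsMultipath G)) where
  open Digraph G
  open IsMatroid M
  open Walks G
  open Parallel G public

  -- If e ∦ g, then ⁅ f ⁆ could be augmented from the multipath ⁅ e ⁆ ∪ ⁅ g ⁆, but f is parallel to both.
  ∥-trans : ∀ {e f g} → e ∥ f → f ∥ g → e ∥ g
  ∥-trans {e} {f} {g} e∥f@(e-nonloop , f-nonloop , _) f∥g@(_ , g-nonloop , _) with e ∥? g
  ... | yes e∥g = e∥g
  ... | no  e∦g =
    ⊥-elim (exchange (augment ⁅ f ⁆ (⁅ e ⁆ ∪ ⁅ g ⁆) (singleton-multipath f-nonloop) eg-multipath sizes))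
    where
    eg-multipath : IsMultipath G (⁅ e ⁆ ∪ ⁅ g ⁆)
    eg-multipath = pair-multipath e-nonloop g-nonloop λ clash → e∦g (e-nonloop , g-nonloop , clash)
    e∉⁅g⁆ : e ∉ ⁅ g ⁆
    e∉⁅g⁆ = x≢y⇒x∉⁅y⁆ λ { refl → e∦g (∥-refl e-nonloop) }
    sizes : ∣ ⁅ f ⁆ ∣ < ∣ ⁅ e ⁆ ∪ ⁅ g ⁆ ∣
    sizes = subst₂ _<_ (sym (∣⁅x⁆∣≡1 f)) (sym (trans (∣⁅x⁆∪p∣≡1+∣p∣ e∉⁅g⁆) (cong suc (∣⁅x⁆∣≡1 g))))
                   (s≤s (s≤s z≤n))
    dependent-with-f : ∀ {x} → f ∥ x → f ≢ x → ¬ IsMultipath G (⁅ f ⁆ ∪ ⁅ x ⁆)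
    dependent-with-f f∥x f≢x = ∥-dependent f∥x f≢x (∈∪⁅⁆-there (x∈⁅x⁆ f)) ∈∪⁅⁆-here
    exchange : ¬ (∃[ x ] (x ∈ ⁅ e ⁆ ∪ ⁅ g ⁆ × x ∉ ⁅ f ⁆ × IsMultipath G (⁅ f ⁆ ∪ ⁅ x ⁆)))
    exchange (x , x∈ , _ , independent) with ∈⁅⁆∪⁻ x∈
    ... | inj₁ refl = dependent-with-f (∥-sym e∥f) (λ { refl → e∦g f∥g }) independent
    ... | inj₂ x∈⁅g⁆ with x∈⁅y⁆⇒x≡y g x∈⁅g⁆
    ...   | refl = dependent-with-f f∥g (λ { refl → e∦g e∥f }) independent

  module _ {X} (loopless : ∀ e → e ∈ X → NonLoop e) (parallel-free : ParallelFree X) where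

    module SimpleCycle {g h₁} (g∈X : g ∈ X) (h₁∈X : h₁ ∈ X) (W₁ : DWalk G X (tgt h₁) (src g))
                       (W-simple : Simple (h₁∈X ∷ W₁)) (closes : tgt g ≡ src h₁) where

      W : DWalk G X (src h₁) (src g)
      W = h₁∈X ∷ W₁

      -- An endpoint of f on the cycle makes f, hence g, parallel to the cycle edge there.
      module _ {f} (g∥f : g ∥ f) where

        clash-on-cycle : ∀ {k} → k ∈ edges W → Clash f k → g ≡ k
        clash-on-cycle k∈W clash =
          parallel-free _ _ g∈X k∈X (∥-trans g∥f (proj₁ (proj₂ g∥f) , loopless _ k∈X , clash))
          where k∈X = edges⊆ W k∈W

        chord-at-src : src f ∈ vertices W → src f ≡ src g
        chord-at-src src∈ with end-or-left W src∈
        ... | inj₁ src≡ = src≡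
        ... | inj₂ (k , k∈W , src≡) with clash-on-cycle k∈W (inj₁ (sym src≡))
        ...   | refl = sym src≡

        chord-at-tgt : tgt f ∈ vertices W → tgt f ≡ tgt g
        chord-at-tgt tgt∈ with start-or-entered W tgt∈
        ... | inj₁ tgt≡ = trans tgt≡ (sym closes)
        ... | inj₂ (k , k∈W , tgt≡) with clash-on-cycle k∈W (inj₂ (inj₁ (sym tgt≡)))
        ...   | refl = sym tgt≡

      X′ : Subset nE
      X′ = ⁅ g ⁆ ∪ edges W₁

      X′-multipath : IsMultipath G X′
      X′-multipath = multipath-snoc (path-multipath W₁ (proj₂ W-simple)) (loopless g g∈X) λ h h∈ →
          ∈∧∉⇒≢ (tgt∈vertices W₁ h∈) tgt-g∉ , ∈∧∉⇒≢ (src∈vertices W₁ h∈) tgt-g∉ ,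
          src≢end W₁ (proj₂ W-simple) h∈
        where tgt-g∉ : tgt g ∉ vertices W₁
              tgt-g∉ = subst (_∉ vertices W₁) (sym closes) (proj₁ W-simple)

      ∣X′∣<∣⁅f⁆∪W∣ : ∀ {f} → f ∉ edges W → ∣ X′ ∣ < ∣ ⁅ f ⁆ ∪ edges W ∣
      ∣X′∣<∣⁅f⁆∪W∣ f∉W = subst₂ _<_
        (trans (∣⁅x⁆∪p∣≡1+∣p∣ (first∉edges h₁∈X W₁ W-simple)) (sym (∣⁅x⁆∪p∣≡1+∣p∣ g∉W₁)))
        (sym (∣⁅x⁆∪p∣≡1+∣p∣ f∉W)) (n<1+n _)
        where g∉W₁ : g ∉ edges W₁
              g∉W₁ g∈ = src≢end W₁ (proj₂ W-simple) g∈ refl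

      closed-by-h₁ : ¬ IsMultipath G (X′ ∪ ⁅ h₁ ⁆)
      closed-by-h₁ (_ , _ , _ , acyclic) =
        acyclic (g , ∈∪⁅⁆-there ∈⁅⁆∪-here ,
                 subst (λ a → DWalk G (X′ ∪ ⁅ h₁ ⁆) a (src g)) (sym closes) (restrict W W⊆))
        where W⊆ : edges W ⊆ X′ ∪ ⁅ h₁ ⁆
              W⊆ x∈ with ∈⁅⁆∪⁻ x∈
              ... | inj₁ refl = ∈∪⁅⁆-here
              ... | inj₂ x∈W₁ = ∈∪⁅⁆-there (∈⁅⁆∪-there x∈W₁)

      -- X′ is the cycle without h₁, so augmenting it from the longer path ⁅ f ⁆ ∪ edges W
      -- can only add f or close the cycle again with h₁.
      exchange : ∀ {f} → IsMultipath G (⁅ f ⁆ ∪ edges W) → f ∉ edges W →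
                 (IsMultipath G (X′ ∪ ⁅ f ⁆) → f ≡ g) → f ≡ g
      exchange {f} Y-multipath f∉W conflict
        with augment X′ (⁅ f ⁆ ∪ edges W) X′-multipath Y-multipath (∣X′∣<∣⁅f⁆∪W∣ f∉W)
      ... | x , x∈Y , x∉X′ , independent with ∈⁅⁆∪⁻ x∈Y
      ...   | inj₁ refl = conflict independent
      ...   | inj₂ x∈W with ∈⁅⁆∪⁻ x∈W
      ...     | inj₁ refl = ⊥-elim (closed-by-h₁ independent)
      ...     | inj₂ x∈W₁ = ⊥-elim (x∉X′ (∈⁅⁆∪-there x∈W₁))

      solitary : Solitary g
      solitary f g∥f@(g-nonloop , f-nonloop , inj₁ src≡) with tgt f ∈? vertices W
      ... | yes tgt∈ = sym (simple g f g-nonloop src≡ (sym (chord-at-tgt g∥f tgt∈)))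
      ... | no  tgt∉ = exchange
        (multipath-snoc (path-multipath W W-simple) f-nonloop λ h h∈ →
          ∈∧∉⇒≢ (tgt∈vertices W h∈) tgt∉ , ∈∧∉⇒≢ (src∈vertices W h∈) tgt∉ ,
          λ src≡src → src≢end W W-simple h∈ (trans src≡src (sym src≡)))
        (λ f∈W → tgt∉ (tgt∈vertices W f∈W))
        (λ (_ , src-injective , _) → src-injective f g ∈∪⁅⁆-here (∈∪⁅⁆-there ∈⁅⁆∪-here) (sym src≡))
      solitary f g∥f@(g-nonloop , f-nonloop , inj₂ (inj₁ tgt≡)) with src f ∈? vertices W
      ... | yes src∈ = sym (simple g f g-nonloop (sym (chord-at-src g∥f src∈)) tgt≡)
      ... | no  src∉ = exchange
        (multipath-cons (path-multipath W W-simple) f-nonloop λ h h∈ →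
          ∈∧∉⇒≢ (src∈vertices W h∈) src∉ , ∈∧∉⇒≢ (tgt∈vertices W h∈) src∉ ,
          λ tgt≡tgt → tgt≢start W W-simple h∈ (trans tgt≡tgt (trans (sym tgt≡) closes)))
        (λ f∈W → src∉ (src∈vertices W f∈W))
        (λ (_ , _ , tgt-injective , _) → tgt-injective f g ∈∪⁅⁆-here (∈∪⁅⁆-there ∈⁅⁆∪-here) (sym tgt≡))
      solitary f g∥f@(g-nonloop , _ , inj₂ (inj₂ (src≡ , tgt≡))) =
        ⊥-elim (g-nonloop (trans (sym (chord-at-src g∥f src∈W)) (sym tgt≡)))
        where src∈W : src f ∈ vertices W
              src∈W = subst (_∈ vertices W) (trans (sym closes) tgt≡) (start∈vertices W)

    cycle-edge-solitary : ∀ {g} → g ∈ X → DWalk G X (tgt g) (src g) → Solitary g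
    cycle-edge-solitary {g} g∈X W = from-simple (proj₁ (erase W)) (proj₂ (erase W)) refl
      where
      from-simple : ∀ {a} (W : DWalk G X a (src g)) → Simple W → tgt g ≡ a → Solitary g
      from-simple []          _        tgt≡src = ⊥-elim (loopless g g∈X (sym tgt≡src))
      from-simple (h₁∈X ∷ W₁) W-simple closes  = SimpleCycle.solitary g∈X h₁∈X W₁ W-simple closes

    solitary-cycle : HasDirectedCycle G X →
                     ∃[ g ] (g ∈ X × Σ (DWalk G X (tgt g) (src g)) λ W →
                             Simple W × Solitary g × (∀ {h} → h ∈ edges W → Solitary h))
    solitary-cycle (g , g∈X , W) =
      g , g∈X , W′ , W′-simple , cycle-edge-solitary g∈X W ,
      λ h∈ → cycle-edge-solitary (edges⊆ W′ h∈) (rotate h∈)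
      where
      W′ = proj₁ (erase W)
      W′-simple = proj₂ (erase W)
      rotate : ∀ {h} → h ∈ edges W′ → DWalk G X (tgt h) (src h)
      rotate h∈ = proj₂ (split-at W′ h∈) ++ (g∈X ∷ proj₁ (split-at W′ h∈))

module Multigraph (G : Digraph) (M : IsMatroid (Digraph.nE G) (IsMultipath G)) where
  open Digraph G
  open Walks G
  open MultipathMatroid G M
  open Data.Nat using (_+_)

  -- Besides the vertices of G, every edge r owns two fresh vertices; the bundle replacing a
  -- parallel class with more than one element joins the pair owned by the least edge of the class.
  data Node : Set where
    vertex              : Fin nV → Node
    classTail classHead : Fin nE → Node

  nNodes : ℕ
  nNodes = nV + (nE + nE)

  node : Node → Fin nNodes
  node (vertex v)    = v ↑ˡ (nE + nE)
  node (classTail r) = nV ↑ʳ (r ↑ˡ nE)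
  node (classHead r) = nV ↑ʳ (nE ↑ʳ r)

  node-injective : ∀ {x y} → node x ≡ node y → x ≡ y
  node-injective {x} {y} eq = trans (sym (decode-node x)) (trans (cong decode eq) (decode-node y))
    where
    decode : Fin nNodes → Node
    decode i with splitAt nV i
    ... | inj₁ v = vertex v
    ... | inj₂ j with splitAt nE j
    ...   | inj₁ r = classTail r
    ...   | inj₂ r = classHead r
    decode-node : ∀ x → decode (node x) ≡ x
    decode-node (vertex v)    rewrite splitAt-↑ˡ nV v (nE + nE) = refl
    decode-node (classTail r) rewrite splitAt-↑ʳ nV (nE + nE) (r ↑ˡ nE) | splitAt-↑ˡ nE r nE = refl
    decode-node (classHead r) rewrite splitAt-↑ʳ nV (nE + nE) (nE ↑ʳ r) | splitAt-↑ʳ nE nE r = refl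

  vertex-injective : ∀ {u v} → vertex u ≡ vertex v → u ≡ v
  vertex-injective refl = refl

  classTail-injective : ∀ {r s} → classTail r ≡ classTail s → r ≡ s
  classTail-injective refl = refl

  module _ (e : Fin nE) (¬solitary : ¬ Solitary e) where

    private
      least-parallel = ¬∀⟶∃¬-smallest nE (λ f → ¬ e ∥ f) (λ f → ¬? (e ∥? f))
                                     λ none → ¬solitary λ f e∥f → ⊥-elim (none f e∥f)

    rep : Fin nE
    rep = proj₁ least-parallel

    ∥-rep : e ∥ rep
    ∥-rep = decidable-stable (e ∥? rep) (proj₁ (proj₂ least-parallel))

    rep-least : ∀ (j : Fin′ rep) → ¬ e ∥ inject j
    rep-least = proj₂ (proj₂ least-parallel)

  rep-cong : ∀ {e f} (e-ns : ¬ Solitary e) (f-ns : ¬ Solitary f) → e ∥ f → rep e e-ns ≡ rep f f-ns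
  rep-cong {f = f} e-ns f-ns e∥f =
    least-unique {P = f ∥_} (∥-trans (∥-sym e∥f) (∥-rep _ e-ns)) (∥-rep _ f-ns)
                 (λ j f∥j → rep-least _ e-ns j (∥-trans e∥f f∥j)) (rep-least _ f-ns)

  rep-injective : ∀ {e f} (e-ns : ¬ Solitary e) (f-ns : ¬ Solitary f) → rep e e-ns ≡ rep f f-ns → e ∥ f
  rep-injective e-ns f-ns eq = ∥-trans (∥-rep _ e-ns) (∥-sym (subst (_ ∥_) (sym eq) (∥-rep _ f-ns)))

  endpoints : Fin nE → Node × Node
  endpoints e with solitary? e
  ... | yes _ = vertex (src e) , vertex (tgt e)
  ... | no ns = classTail (rep e ns) , classHead (rep e ns)

  ends : Fin nE → Fin nNodes × Fin nNodes
  ends = Product.map node node ∘ endpoints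

  endpoints-solitary : ∀ {e} → Solitary e → endpoints e ≡ (vertex (src e) , vertex (tgt e))
  endpoints-solitary {e} solitary with solitary? e
  ... | yes _ = refl
  ... | no ns = ⊥-elim (ns solitary)

  endpoints-¬solitary : ∀ {e} (ns : ¬ Solitary e) →
                        endpoints e ≡ (classTail (rep e ns) , classHead (rep e ns))
  endpoints-¬solitary {e} ns with solitary? e
  ... | yes solitary = ⊥-elim (ns solitary)
  ... | no ns′ = cong (λ r → classTail r , classHead r) (rep-cong ns′ ns (∥-refl (¬solitary⇒nonloop ns)))

  ends-solitary : ∀ {e} → Solitary e → ends e ≡ (node (vertex (src e)) , node (vertex (tgt e)))
  ends-solitary = cong (Product.map node node) ∘ endpoints-solitary

  ends-∥ : ∀ {e f} → e ∥ f → e ≢ f → ends e ≡ ends f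
  ends-∥ e∥f e≢f = cong (Product.map node node) (begin
    endpoints _                                     ≡⟨ endpoints-¬solitary e-ns ⟩
    classTail (rep _ e-ns) , classHead (rep _ e-ns) ≡⟨ cong (λ r → classTail r , classHead r)
                                                             (rep-cong e-ns f-ns e∥f) ⟩
    classTail (rep _ f-ns) , classHead (rep _ f-ns) ≡⟨ sym (endpoints-¬solitary f-ns) ⟩
    endpoints _                                     ∎)
    where open ≡.≡-Reasoning
          e-ns = ∥⇒¬solitary e∥f (e≢f ∘ sym)
          f-ns = ∥⇒¬solitary (∥-sym e∥f) e≢f

  forest⇒multipath : ∀ {X} → IsForest ends X → IsMultipath G X
  forest⇒multipath {X} forest =
    loopless , (λ _ _ e∈X f∈X → clash⇒≡ e∈X f∈X ∘ inj₁) , (λ _ _ e∈X f∈X → clash⇒≡ e∈X f∈X ∘ inj₂ ∘ inj₁) ,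
    acyclic
    where
    loopless : ∀ e → e ∈ X → NonLoop e
    loopless e e∈X loop = forest (node (vertex (src e)) , e , [] , inj₁ joins ∷ [] , [] ∷ [] , e∈X ∷ [])
      where joins : ends e ≡ (node (vertex (src e)) , node (vertex (src e)))
            joins = trans (ends-solitary λ f e∥f → ⊥-elim (proj₁ e∥f loop))
                          (cong (λ v → node (vertex (src e)) , node (vertex v)) (sym loop))

    parallel-free : ParallelFree X
    parallel-free e f e∈X f∈X e∥f with e ≟ f
    ... | yes e≡f = e≡f
    ... | no  e≢f = ⊥-elim (forest (proj₁ (ends e) , e , f ∷ [] ,
                                    inj₁ refl ∷ inj₂ (ends-∥ (∥-sym e∥f) (e≢f ∘ sym)) ∷ [] ,
                                    (e≢f ∷ []) ∷ [] ∷ [] , e∈X ∷ f∈X ∷ []))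

    clash⇒≡ : ∀ {e f} → e ∈ X → f ∈ X → Clash e f → e ≡ f
    clash⇒≡ e∈X f∈X clash = parallel-free _ _ e∈X f∈X (loopless _ e∈X , loopless _ f∈X , clash)

    undirected : ∀ {u v} (W : DWalk G X u v) → (∀ {h} → h ∈ edges W → Solitary h) →
                 UWalk ends (node (vertex u)) (node (vertex v)) (edgeList W)
    undirected []      _        = []
    undirected (_ ∷ W) solitary =
      inj₁ (ends-solitary (solitary ∈⁅⁆∪-here)) ∷ undirected W (solitary ∘ ∈⁅⁆∪-there)

    acyclic : ¬ HasDirectedCycle G X
    acyclic cycle with solitary-cycle loopless parallel-free cycle
    ... | g , g∈X , W , W-simple , g-solitary , W-solitary =
      forest (node (vertex (src g)) , g , edgeList W ,
              inj₁ (ends-solitary g-solitary) ∷ undirected W W-solitary ,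
              all-edges W (λ h∈ g≡h → src≢end W W-simple h∈ (cong src (sym g≡h)))
                ∷ edgeList-unique W W-simple ,
              g∈X ∷ all-edges W (edges⊆ W))

  module _ {c ℓ} (F : Field c ℓ) where
    open Field F using (Carrier; _≈_; _*_; 0#; 1#; zeroˡ; zeroʳ; *-congˡ; *-congʳ) renaming (trans to ≈-trans)
    open Incidence F using (incidence; incidence-tail; incidence-elsewhere; pivot-zero)

    incidence-node-tail : ∀ {e a b} → endpoints e ≡ (a , b) → a ≢ b → incidence ends (node a) e ≈ 1#
    incidence-node-tail eq a≢b = incidence-tail ends (cong (Product.map node node) eq) (a≢b ∘ node-injective)

    incidence-node-elsewhere : ∀ {e a b} x → endpoints e ≡ (a , b) → x ≢ a → x ≢ b →
                               incidence ends (node x) e ≈ 0#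
    incidence-node-elsewhere x eq x≢a x≢b =
      incidence-elsewhere ends (cong (Product.map node node) eq) (x≢a ∘ node-injective) (x≢b ∘ node-injective)

    module Independence {X} (X-multipath : IsMultipath G X) (coef : Fin nE → Carrier)
                        (supported : ∀ e → e ∉ X → coef e ≈ 0#)
                        (rows : ∀ i → sumF F (λ e → coef e * incidence ends i e) ≈ 0#) where
      A = incidence ends
      loopless      = proj₁ X-multipath
      src-injective = proj₁ (proj₂ X-multipath)
      tgt-injective = proj₁ (proj₂ (proj₂ X-multipath))
      acyclic       = proj₂ (proj₂ (proj₂ X-multipath))

      zero-by-row : ∀ {e} i → A i e ≈ 1# → (∀ f → f ≢ e → f ∈ X → coef f ≈ 0# ⊎ A i f ≈ 0#) → coef e ≈ 0#
      zero-by-row {e} i Aie≈1 negligible = pivot-zero A coef {i} {e} (rows i) Aie≈1 term≈0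
        where
        term≈0 : ∀ f → f ≢ e → coef f * A i f ≈ 0#
        term≈0 f f≢e with f ∈? X
        ... | no  f∉X = ≈-trans (*-congʳ (supported f f∉X)) (zeroˡ _)
        ... | yes f∈X = [ (λ c≈0 → ≈-trans (*-congʳ c≈0) (zeroˡ _)) ,
                          (λ A≈0 → ≈-trans (*-congˡ A≈0) (zeroʳ _)) ] (negligible f f≢e f∈X)

      zero-solitary : ∀ {e} → e ∈ X → Solitary e → (∀ h → h ∈ X → tgt h ≡ src e → coef h ≈ 0#) → coef e ≈ 0#
      zero-solitary {e} e∈X e-solitary entering =
        zero-by-row (node (vertex (src e)))
          (incidence-node-tail (endpoints-solitary e-solitary) (loopless e e∈X ∘ vertex-injective)) negligible
        where
        negligible : ∀ f → f ≢ e → f ∈ X → coef f ≈ 0# ⊎ A (node (vertex (src e))) f ≈ 0#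
        negligible f f≢e f∈X = case solitary? f of λ where
          (no f-ns) →
            inj₂ (incidence-node-elsewhere (vertex (src e)) (endpoints-¬solitary f-ns) (λ ()) (λ ()))
          (yes f-solitary) → case tgt f ≟ src e of λ where
            (yes tgt≡) → inj₁ (entering f f∈X tgt≡)
            (no  tgt≢) → inj₂ (incidence-node-elsewhere (vertex (src e)) (endpoints-solitary f-solitary)
              (λ eq → f≢e (src-injective f e f∈X e∈X (sym (vertex-injective eq))))
              (λ eq → tgt≢ (sym (vertex-injective eq))))

      zero-¬solitary : ∀ {e} → e ∈ X → (e-ns : ¬ Solitary e) → coef e ≈ 0#
      zero-¬solitary {e} e∈X e-ns =
        zero-by-row (node (classTail (rep e e-ns)))
          (incidence-node-tail (endpoints-¬solitary e-ns) λ ()) negligible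
        where
        negligible : ∀ f → f ≢ e → f ∈ X → coef f ≈ 0# ⊎ A (node (classTail (rep e e-ns))) f ≈ 0#
        negligible f f≢e f∈X = inj₂ (case solitary? f of λ where
          (yes f-solitary) →
            incidence-node-elsewhere (classTail (rep e e-ns)) (endpoints-solitary f-solitary) (λ ()) (λ ())
          (no  f-ns) → incidence-node-elsewhere (classTail (rep e e-ns)) (endpoints-¬solitary f-ns)
            (λ eq → ∥-dependent (rep-injective e-ns f-ns (classTail-injective eq)) (f≢e ∘ sym)
                                e∈X f∈X X-multipath)
            (λ ()))

      zero-along : ∀ {u v} → DWalk G X u v →
                   (∀ h → h ∈ X → tgt h ≡ u → coef h ≈ 0#) → ∀ h → h ∈ X → tgt h ≡ v → coef h ≈ 0#
      zero-along []                  entering-start = entering-start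
      zero-along (_∷_ {e = e} e∈X W) entering-start = zero-along W entering-tgt-e
        where
        coef-e≈0 : coef e ≈ 0#
        coef-e≈0 with solitary? e
        ... | yes e-solitary = zero-solitary e∈X e-solitary entering-start
        ... | no  e-ns       = zero-¬solitary e∈X e-ns
        entering-tgt-e : ∀ h → h ∈ X → tgt h ≡ tgt e → coef h ≈ 0#
        entering-tgt-e h h∈X tgt≡ with tgt-injective h e h∈X e∈X tgt≡
        ... | refl = coef-e≈0

      coef≈0 : ∀ e → coef e ≈ 0#
      coef≈0 e with e ∈? X
      ... | no  e∉X = supported e e∉X
      ... | yes e∈X with source-walk acyclic (tgt e)
      ...   | _ , unentered , W = zero-along W (λ h h∈X → ⊥-elim ∘ unentered h h∈X) e e∈X refl

    multipath⇒independent : ∀ {X} → IsMultipath G X → LinIndep F (incidence ends) X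
    multipath⇒independent X-multipath coef supported rows =
      Independence.coef≈0 X-multipath coef supported rows

  -- Cycles are dependent over every field, so any single field detects them.
  multipath⇒forest : ∀ {X} → IsMultipath G X → IsForest ends X
  multipath⇒forest = Incidence.independent⇒forest 𝔽₂ ends ∘ multipath⇒independent 𝔽₂

corollary4p25 : (G : Digraph) → IsMatroid (Digraph.nE G) (IsMultipath G) → RegularAndGraphic (IsMultipath G)
corollary4p25 G M = record
  { regular = λ F → nNodes , incidence F ends , λ X →
                multipath⇒independent F , forest⇒multipath ∘ independent⇒forest F ends
  ; graphic = nNodes , ends , λ X → multipath⇒forest , forest⇒multipath
  }
  where
  open Multigraph G M
  open Incidence using (incidence; independent⇒forest)
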